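{- Let $(L;\wedge,\vee,^{\Delta},^{\nabla},0,1)$ be a weakly dicomplemented lattice. Let $F(\overline{S}(L))$ be the set of filters of $\overline{S}(L)$, $F(L)$ the set of filters of $L$ and $SF(L)$ the set of S-filters of $L$, all ordered by inclusion. For $G\in F(\overline{S}(L))$ put $F_G=\{x\in L\mid x^{\Delta\Delta}\in G\}$ and $G^{\overline{\star}}=\{x\in\overline{S}(L)\mid a^{\Delta}\le x\ \forall a\in G\}$; for $F\in SF(L)$ put $F^{\star}=\{a\in L\mid x^{\Delta}\le a\ \forall x\in F\}$. Then: (1) the map $\phi:F(\overline{S}(L))\to F(L)$, $G\mapsto F_G$, is injective and order-preserving; (2) the algebras $(F(\overline{S}(L));\cap,\underline{\vee},^{\overline{\star}},\{1\},\overline{S}(L))$ and $(SF(L);\cap,\underline{\vee},^{\star},\{1\},L)$ are isomorphic, where in each $\underline{\vee}$ denotes the join in the respective lattice ordered by inclusion; (3) letting $S(F(\overline{S}(L)))=\{G\in F(\overline{S}(L))\mid G^{\overline{\star}\,\overline{\star}}=G\}$ and $S(SF(L))=\{F\in SF(L)\mid F^{\star\star}=F\}$, each ordered by inclusion and equipped with the complementation $^{\overline{\star}}$, resp. $^{\star}$, these are ortholattices and they are isomorphic ortholattices.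
   Context: A weakly dicomplemented lattice (WDL) is an algebra $(L;\wedge,\vee,^{\Delta},^{\nabla},0,1)$ such that $(L;\wedge,\vee,0,1)$ is a bounded lattice and, for all $x,y\in L$: $x^{\Delta\Delta}\le x$; $x\le y\Rightarrow y^{\Delta}\le x^{\Delta}$; $(x\wedge y)\vee(x\wedge y^{\Delta})=x$; $x^{\nabla\nabla}\ge x$; $x\le y\Rightarrow y^{\nabla}\le x^{\nabla}$; $(x\vee y)\wedge(x\vee y^{\nabla})=x$. A filter of $L$ is a nonempty upward closed subset closed under $\wedge$. $\overline{S}(L)=\{x\in L\mid x^{\Delta\Delta}=x\}$, $x\,\overline{\sqcap}\,y=(x^{\Delta}\vee y^{\Delta})^{\Delta}$; $(\overline{S}(L);\overline{\sqcap},\vee,^{\Delta},0,1)$ is an ortholattice, and a filter of $\overline{S}(L)$ is a nonempty subset of $\overline{S}(L)$ upward closed within $\overline{S}(L)$ and closed under $\overline{\sqcap}$. An S-filter of $L$ is a filter $F$ of $L$ with $x\,\overline{\sqcap}\,y\in F$ whenever $x,y\in F$. An ortholattice is a bounded lattice with an order-reversing involution $^{\perp}$ with $a\vee a^{\perp}=1$ and $a\wedge a^{\perp}=0$. -}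

module Defs where

open import Level using (0ℓ)
open import Data.Product using (Σ; ∃; _×_; _,_)
open import Relation.Binary.PropositionalEquality using (_≡_)
open import Data.Unit using (⊤)
import Algebra.Lattice.Structures as LS

record WDL : Set₁ where
  infixr 7 _∧_
  infixr 6 _∨_
  infix 4 _≤_
  field
    Carrier : Set
    _∧_ _∨_ : Carrier → Carrier → Carrier
    _ᐞ _ᐁ   : Carrier → Carrier          -- x ᐞ = x^Δ ,  x ᐁ = x^∇
    𝟘 𝟙     : Carrier
    isLattice : LS.IsLattice (_≡_ {A = Carrier}) _∨_ _∧_

  _≤_ : Carrier → Carrier → Set
  x ≤ y = x ∧ y ≡ x

  field
    𝟘-least    : ∀ x → 𝟘 ≤ x
    𝟙-greatest : ∀ x → x ≤ 𝟙
    ᐞᐞ-≤     : ∀ x → (x ᐞ) ᐞ ≤ x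
    ᐞ-anti   : ∀ x y → x ≤ y → y ᐞ ≤ x ᐞ
    ᐞ-split  : ∀ x y → (x ∧ y) ∨ (x ∧ y ᐞ) ≡ x
    ᐁᐁ-≥     : ∀ x → x ≤ (x ᐁ) ᐁ
    ᐁ-anti   : ∀ x y → x ≤ y → y ᐁ ≤ x ᐁ
    ᐁ-split  : ∀ x y → (x ∨ y) ∧ (x ∨ y ᐁ) ≡ x

module _ {A : Set} where

  Subset : Set₁
  Subset = A → Set

  infix 4 _⊆_ _≐_
  _⊆_ : Subset → Subset → Set
  S ⊆ T = ∀ x → S x → T x

  _≐_ : Subset → Subset → Set
  S ≐ T = (S ⊆ T) × (T ⊆ S)

  _∩_ : Subset → Subset → Subset
  (S ∩ T) x = S x × T x

  IsLUB : (Subset → Set) → Subset → Subset → Subset → Set₁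
  IsLUB P S T J = P J × S ⊆ J × T ⊆ J × (∀ K → P K → S ⊆ K → T ⊆ K → J ⊆ K)

  IsGLB : (Subset → Set) → Subset → Subset → Subset → Set₁
  IsGLB P S T M = P M × M ⊆ S × M ⊆ T × (∀ K → P K → K ⊆ S → K ⊆ T → K ⊆ M)

  IsTop : (Subset → Set) → Subset → Set₁
  IsTop P T = P T × (∀ K → P K → K ⊆ T)

  IsBottom : (Subset → Set) → Subset → Set₁
  IsBottom P B = P B × (∀ K → P K → B ⊆ K)

  record IsOrthoLattice (P : Subset → Set) (comp : Subset → Subset) : Set₁ where
    field
      comp-closed : ∀ S → P S → P (comp S)
      joins       : ∀ S T → P S → P T → Σ Subset (IsLUB P S T)
      meets       : ∀ S T → P S → P T → Σ Subset (IsGLB P S T)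
      top         : Σ Subset (IsTop P)
      bottom      : Σ Subset (IsBottom P)
      comp-anti   : ∀ S T → P S → P T → S ⊆ T → comp T ⊆ comp S
      comp-invol  : ∀ S → P S → comp (comp S) ≐ S
      comp-join   : ∀ S J → P S → IsLUB P S (comp S) J → IsTop P J
      comp-meet   : ∀ S M → P S → IsGLB P S (comp S) M → IsBottom P M

  record IsOLIso (P₁ P₂ : Subset → Set) (comp₁ comp₂ : Subset → Subset)
                 (f g : Subset → Subset) : Set₁ where
    field
      f-into    : ∀ S → P₁ S → P₂ (f S)
      g-into    : ∀ T → P₂ T → P₁ (g T)
      gf≐id     : ∀ S → P₁ S → g (f S) ≐ S
      fg≐id     : ∀ T → P₂ T → f (g T) ≐ T
      f-resp    : ∀ S S' → P₁ S → P₁ S' → S ≐ S' → f S ≐ f S'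
      g-resp    : ∀ T T' → P₂ T → P₂ T' → T ≐ T' → g T ≐ g T'
      f-order   : ∀ S S' → P₁ S → P₁ S' → (S ⊆ S' → f S ⊆ f S') × (f S ⊆ f S' → S ⊆ S')
      f-join    : ∀ S S' J → P₁ S → P₁ S' → P₁ J →
                    (IsLUB P₁ S S' J → IsLUB P₂ (f S) (f S') (f J)) ×
                    (IsLUB P₂ (f S) (f S') (f J) → IsLUB P₁ S S' J)
      f-meet    : ∀ S S' M → P₁ S → P₁ S' → P₁ M →
                    (IsGLB P₁ S S' M → IsGLB P₂ (f S) (f S') (f M)) ×
                    (IsGLB P₂ (f S) (f S') (f M) → IsGLB P₁ S S' M)
      f-comp    : ∀ S → P₁ S → f (comp₁ S) ≐ comp₂ (f S)

module WDLNotions (W : WDL) where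
  open WDL W public

  S̄ : Subset
  S̄ x = (x ᐞ) ᐞ ≡ x

  _⊓̄_ : Carrier → Carrier → Carrier
  x ⊓̄ y = (x ᐞ ∨ y ᐞ) ᐞ

  record IsFilter (F : Subset) : Set where
    field
      nonempty : ∃ λ x → F x
      up       : ∀ x y → F x → x ≤ y → F y
      meet     : ∀ x y → F x → F y → F (x ∧ y)

  record IsFilterS̄ (G : Subset) : Set where
    field
      inside   : G ⊆ S̄
      nonempty : ∃ λ x → G x
      up       : ∀ x y → G x → S̄ y → x ≤ y → G y
      meet     : ∀ x y → G x → G y → G (x ⊓̄ y)

  record IsSFilter (F : Subset) : Set where
    field
      isFilter : IsFilter F
      ⊓̄-closed : ∀ x y → F x → F y → F (x ⊓̄ y)

  F[_] : Subset → Subset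
  F[ G ] x = G ((x ᐞ) ᐞ)

  _⋆̄ : Subset → Subset
  (G ⋆̄) x = S̄ x × (∀ a → G a → a ᐞ ≤ x)

  _⋆ : Subset → Subset
  (F ⋆) a = ∀ x → F x → x ᐞ ≤ a

  ｛𝟙｝ : Subset
  ｛𝟙｝ x = x ≡ 𝟙

  Full : Subset {Carrier}
  Full _ = ⊤

  IsRegFilterS̄ : Subset → Set
  IsRegFilterS̄ G = IsFilterS̄ G × ((G ⋆̄) ⋆̄ ≐ G)

  IsRegSFilter : Subset → Set
  IsRegSFilter F = IsSFilter F × ((F ⋆) ⋆ ≐ F)

{-# OPTIONS --safe #-}
-- G ↦ F_G and F ↦ S̄(L) ∩ F are mutually inverse inclusion-preserving maps
-- between filters of S̄(L) and S-filters of L: an S-filter is closed under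
-- x ↦ x ⊓̄ x = x^ΔΔ, and x^ΔΔ ≤ x.  They also intertwine ⋆̄ and ⋆, since
-- a^Δ ≤ x^ΔΔ iff a^Δ ≤ x.  An order isomorphism preserves all existing
-- meets and joins, and one commuting with the complementations restricts
-- to the regular (⋆⋆-closed) elements.  That these regular elements form
-- an ortholattice is the usual argument for an antitone Galois closure:
-- meets are intersections, S ∨ T = (S⋆ ∩ T⋆)⋆, and S ∩ S⋆ = {1} because
-- x^Δ ≤ x forces x = x ∨ x^Δ = 1.
module Submission where

open import Defs
open import Data.Product using (Σ; _×_; _,_; proj₁; proj₂)
open import Data.Unit using (tt)
open import Relation.Binary.PropositionalEquality
  using (_≡_; sym; trans; cong; cong₂; subst; module ≡-Reasoning)
open import Relation.Binary.Bundles using (Preorder)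
open import Relation.Binary.Structures using (IsEquivalence)
open import Algebra.Lattice.Bundles using (Lattice)
import Algebra.Lattice.Properties.Lattice as LatticeProperties
import Algebra.Lattice.Structures as LS
import Relation.Binary.Lattice as OrderTheoretic
import Relation.Binary.Reasoning.Preorder as PreorderReasoning

module _ {A : Set} where

  ⊆-refl : (S : Subset {A}) → S ⊆ S
  ⊆-refl S x Sx = Sx

  ⊆-trans : {S T U : Subset {A}} → S ⊆ T → T ⊆ U → S ⊆ U
  ⊆-trans S⊆T T⊆U x Sx = T⊆U x (S⊆T x Sx)

  ≐-refl : {S : Subset {A}} → S ≐ S
  ≐-refl {S} = ⊆-refl S , ⊆-refl S

  ≐-sym : {S T : Subset {A}} → S ≐ T → T ≐ S
  ≐-sym (S⊆T , T⊆S) = T⊆S , S⊆T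

  ≐-trans : {S T U : Subset {A}} → S ≐ T → T ≐ U → S ≐ U
  ≐-trans (S⊆T , T⊆S) (T⊆U , U⊆T) = ⊆-trans S⊆T T⊆U , ⊆-trans U⊆T T⊆S

  ≐-isEquivalence : IsEquivalence (_≐_ {A})
  ≐-isEquivalence = record { refl = ≐-refl ; sym = ≐-sym ; trans = ≐-trans }

  ⊆-preorder : Preorder _ _ _
  ⊆-preorder = record
    { Carrier    = Subset {A}
    ; _≈_        = _≐_
    ; _≲_        = _⊆_
    ; isPreorder = record
      { isEquivalence = ≐-isEquivalence
      ; reflexive     = proj₁
      ; trans         = ⊆-trans
      }
    }

  Monotone Antitone : (Subset {A} → Subset {A}) → Set₁
  Monotone f = ∀ S T → S ⊆ T → f S ⊆ f T
  Antitone f = ∀ S T → S ⊆ T → f T ⊆ f S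

  Monotone-resp-≐ : {f : Subset {A} → Subset {A}} → Monotone f → ∀ {S T} → S ≐ T → f S ≐ f T
  Monotone-resp-≐ f-mono (S⊆T , T⊆S) = f-mono _ _ S⊆T , f-mono _ _ T⊆S

  Antitone-resp-≐ : {f : Subset {A} → Subset {A}} → Antitone f → ∀ {S T} → S ≐ T → f S ≐ f T
  Antitone-resp-≐ f-anti (S⊆T , T⊆S) = f-anti _ _ T⊆S , f-anti _ _ S⊆T

  Regular : (Subset {A} → Set) → (Subset {A} → Subset {A}) → Subset {A} → Set
  Regular P comp S = P S × (comp (comp S) ≐ S)

module RegularOrthoLattice
  {A : Set} (P : Subset {A} → Set) (comp : Subset {A} → Subset {A}) (Top Bot : Subset {A})
  (P-∩ : ∀ S T → P S → P T → P (S ∩ T))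
  (P-Top : P Top) (Top-greatest : ∀ S → P S → S ⊆ Top) (Bot-least : ∀ S → P S → Bot ⊆ S)
  (comp-closed : ∀ S → P (comp S))
  (comp-anti : Antitone comp)
  (comp-extensive : ∀ S → P S → S ⊆ comp (comp S))
  (comp-disjoint : ∀ S → S ∩ comp S ⊆ Bot)
  (comp-Bot : ∀ S → S ⊆ Bot → Top ⊆ comp S)
  where

  private
    Reg : Subset {A} → Set
    Reg = Regular P comp

  comp-Regular : ∀ S → P S → Reg (comp S)
  comp-Regular S PS =
    comp-closed S , comp-anti _ _ (comp-extensive S PS) , comp-extensive (comp S) (comp-closed S)

  comp-comp-mono : Monotone (λ S → comp (comp S))
  comp-comp-mono S T S⊆T = comp-anti _ _ (comp-anti _ _ S⊆T)

  ∩-Regular : ∀ S T → Reg S → Reg T → Reg (S ∩ T)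
  ∩-Regular S T (PS , (ccS⊆S , _)) (PT , (ccT⊆T , _)) =
    P-∩ S T PS PT ,
    (λ x ccx → ccS⊆S x (comp-comp-mono _ _ (λ _ → proj₁) x ccx) ,
               ccT⊆T x (comp-comp-mono _ _ (λ _ → proj₂) x ccx)) ,
    comp-extensive (S ∩ T) (P-∩ S T PS PT)

  join-isLUB : ∀ S T → Reg S → Reg T → IsLUB Reg S T (comp (comp S ∩ comp T))
  join-isLUB S T (PS , _) (PT , _) =
    comp-Regular _ (P-∩ _ _ (comp-closed S) (comp-closed T)) ,
    ⊆-trans (comp-extensive S PS) (comp-anti _ _ (λ _ → proj₁)) ,
    ⊆-trans (comp-extensive T PT) (comp-anti _ _ (λ _ → proj₂)) ,
    λ K (_ , ccK≐K) S⊆K T⊆K →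
      ⊆-trans (comp-anti _ _ (λ x cKx → comp-anti _ _ S⊆K x cKx , comp-anti _ _ T⊆K x cKx))
              (proj₁ ccK≐K)

  ∩-isGLB : ∀ S T → Reg S → Reg T → IsGLB Reg S T (S ∩ T)
  ∩-isGLB S T RS RT =
    ∩-Regular S T RS RT , (λ _ → proj₁) , (λ _ → proj₂) , λ K _ K⊆S K⊆T x Kx → K⊆S x Kx , K⊆T x Kx

  Top-isTop : IsTop Reg Top
  Top-isTop =
    (P-Top , Top-greatest _ (comp-closed (comp Top)) , comp-extensive Top P-Top) ,
    λ K RK → Top-greatest K (proj₁ RK)

  compTop-isBottom : IsBottom Reg (comp Top)
  compTop-isBottom =
    comp-Regular Top P-Top ,
    λ K RK x cTx →
      Bot-least K (proj₁ RK) x (comp-disjoint Top x (Top-greatest _ (comp-closed Top) x cTx , cTx))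

  join-comp-isTop : ∀ S J → Reg S → IsLUB Reg S (comp S) J → IsTop Reg J
  join-comp-isTop S J _ (RJ@(_ , ccJ≐J) , S⊆J , cS⊆J , _) =
    RJ ,
    λ K RK → ⊆-trans (Top-greatest K (proj₁ RK)) (⊆-trans (comp-Bot (comp J) cJ⊆Bot) (proj₁ ccJ≐J))
    where
      cJ⊆Bot : comp J ⊆ Bot
      cJ⊆Bot x cJx = comp-disjoint (comp S) x (comp-anti _ _ S⊆J x cJx , comp-anti _ _ cS⊆J x cJx)

  meet-comp-isBottom : ∀ S M → Reg S → IsGLB Reg S (comp S) M → IsBottom Reg M
  meet-comp-isBottom S M _ (RM , M⊆S , M⊆cS , _) =
    RM , λ K RK x Mx → Bot-least K (proj₁ RK) x (comp-disjoint S x (M⊆S x Mx , M⊆cS x Mx))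

  isOrthoLattice : IsOrthoLattice Reg comp
  isOrthoLattice = record
    { comp-closed = λ S RS → comp-Regular S (proj₁ RS)
    ; joins       = λ S T RS RT → _ , join-isLUB S T RS RT
    ; meets       = λ S T RS RT → _ , ∩-isGLB S T RS RT
    ; top         = Top , Top-isTop
    ; bottom      = comp Top , compTop-isBottom
    ; comp-anti   = λ S T _ _ → comp-anti S T
    ; comp-invol  = λ S RS → proj₂ RS
    ; comp-join   = join-comp-isTop
    ; comp-meet   = meet-comp-isBottom
    }

module OrderIsomorphism
  {A : Set} (P₁ P₂ : Subset {A} → Set) (comp₁ comp₂ f g : Subset {A} → Subset {A})
  (f-mono : Monotone f) (g-mono : Monotone g)
  (f-into : ∀ S → P₁ S → P₂ (f S)) (g-into : ∀ T → P₂ T → P₁ (g T))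
  (gf≐id : ∀ S → P₁ S → g (f S) ≐ S) (fg≐id : ∀ T → P₂ T → f (g T) ≐ T)
  (f-comp : ∀ S → P₁ S → f (comp₁ S) ≐ comp₂ (f S))
  where

  open PreorderReasoning (⊆-preorder {A})

  f⊆⇒⊆g : ∀ {S T} → P₁ S → f S ⊆ T → S ⊆ g T
  f⊆⇒⊆g {S} {T} PS fS⊆T = begin
    S         ≈⟨ ≐-sym (gf≐id S PS) ⟩
    g (f S)   ≲⟨ g-mono _ _ fS⊆T ⟩
    g T       ∎

  ⊆g⇒f⊆ : ∀ {S T} → P₂ T → S ⊆ g T → f S ⊆ T
  ⊆g⇒f⊆ {S} {T} PT S⊆gT = begin
    f S       ≲⟨ f-mono _ _ S⊆gT ⟩
    f (g T)   ≈⟨ fg≐id T PT ⟩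
    T         ∎

  ⊆f⇒g⊆ : ∀ {S T} → P₁ S → T ⊆ f S → g T ⊆ S
  ⊆f⇒g⊆ {S} {T} PS T⊆fS = begin
    g T       ≲⟨ g-mono _ _ T⊆fS ⟩
    g (f S)   ≈⟨ gf≐id S PS ⟩
    S         ∎

  g⊆⇒⊆f : ∀ {S T} → P₂ T → g T ⊆ S → T ⊆ f S
  g⊆⇒⊆f {S} {T} PT gT⊆S = begin
    T         ≈⟨ ≐-sym (fg≐id T PT) ⟩
    f (g T)   ≲⟨ f-mono _ _ gT⊆S ⟩
    f S       ∎

  f-reflects-⊆ : ∀ {S S'} → P₁ S → P₁ S' → f S ⊆ f S' → S ⊆ S'
  f-reflects-⊆ PS PS' fS⊆fS' = ⊆-trans (f⊆⇒⊆g PS fS⊆fS') (proj₁ (gf≐id _ PS'))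

  f-injective : ∀ {S S'} → P₁ S → P₁ S' → f S ≐ f S' → S ≐ S'
  f-injective PS PS' (fS⊆fS' , fS'⊆fS) = f-reflects-⊆ PS PS' fS⊆fS' , f-reflects-⊆ PS' PS fS'⊆fS

  f-preserves-lub : ∀ {S S' J} → P₁ S → P₁ S' → IsLUB P₁ S S' J → IsLUB P₂ (f S) (f S') (f J)
  f-preserves-lub PS PS' (PJ , S⊆J , S'⊆J , least) =
    f-into _ PJ , f-mono _ _ S⊆J , f-mono _ _ S'⊆J ,
    λ K PK fS⊆K fS'⊆K →
      ⊆g⇒f⊆ PK (least (g K) (g-into K PK) (f⊆⇒⊆g PS fS⊆K) (f⊆⇒⊆g PS' fS'⊆K))

  f-reflects-lub : ∀ {S S' J} → P₁ S → P₁ S' → P₁ J → IsLUB P₂ (f S) (f S') (f J) → IsLUB P₁ S S' J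
  f-reflects-lub PS PS' PJ (_ , fS⊆fJ , fS'⊆fJ , least) =
    PJ , f-reflects-⊆ PS PJ fS⊆fJ , f-reflects-⊆ PS' PJ fS'⊆fJ ,
    λ K PK S⊆K S'⊆K →
      f-reflects-⊆ PJ PK (least (f K) (f-into K PK) (f-mono _ _ S⊆K) (f-mono _ _ S'⊆K))

  f-preserves-glb : ∀ {S S' M} → P₁ S → P₁ S' → IsGLB P₁ S S' M → IsGLB P₂ (f S) (f S') (f M)
  f-preserves-glb PS PS' (PM , M⊆S , M⊆S' , greatest) =
    f-into _ PM , f-mono _ _ M⊆S , f-mono _ _ M⊆S' ,
    λ K PK K⊆fS K⊆fS' →
      g⊆⇒⊆f PK (greatest (g K) (g-into K PK) (⊆f⇒g⊆ PS K⊆fS) (⊆f⇒g⊆ PS' K⊆fS'))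

  f-reflects-glb : ∀ {S S' M} → P₁ S → P₁ S' → P₁ M → IsGLB P₂ (f S) (f S') (f M) → IsGLB P₁ S S' M
  f-reflects-glb PS PS' PM (_ , fM⊆fS , fM⊆fS' , greatest) =
    PM , f-reflects-⊆ PM PS fM⊆fS , f-reflects-⊆ PM PS' fM⊆fS' ,
    λ K PK K⊆S K⊆S' →
      f-reflects-⊆ PK PM (greatest (f K) (f-into K PK) (f-mono _ _ K⊆S) (f-mono _ _ K⊆S'))

  isOLIso : IsOLIso P₁ P₂ comp₁ comp₂ f g
  isOLIso = record
    { f-into  = f-into
    ; g-into  = g-into
    ; gf≐id   = gf≐id
    ; fg≐id   = fg≐id
    ; f-resp  = λ _ _ _ _ → Monotone-resp-≐ f-mono
    ; g-resp  = λ _ _ _ _ → Monotone-resp-≐ g-mono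
    ; f-order = λ S S' PS PS' → f-mono S S' , f-reflects-⊆ PS PS'
    ; f-join  = λ S S' J PS PS' PJ → f-preserves-lub PS PS' , f-reflects-lub PS PS' PJ
    ; f-meet  = λ S S' M PS PS' PM → f-preserves-glb PS PS' , f-reflects-glb PS PS' PM
    ; f-comp  = f-comp
    }

module RegularOrderIsomorphism
  {A : Set} {P₁ P₂ : Subset {A} → Set} {comp₁ comp₂ f g : Subset {A} → Subset {A}}
  (f-mono : Monotone f) (g-mono : Monotone g) (iso : IsOLIso P₁ P₂ comp₁ comp₂ f g)
  (comp₁-anti : Antitone comp₁) (comp₂-anti : Antitone comp₂)
  (comp₁-closed : ∀ S → P₁ S → P₁ (comp₁ S)) (comp₂-closed : ∀ T → P₂ T → P₂ (comp₂ T))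
  where

  open PreorderReasoning (⊆-preorder {A})
  open IsOLIso iso using (f-into; g-into; gf≐id; fg≐id; f-comp)

  g-comp : ∀ T → P₂ T → g (comp₂ T) ≐ comp₁ (g T)
  g-comp T PT = begin-equality
    g (comp₂ T)               ≈⟨ Monotone-resp-≐ g-mono (Antitone-resp-≐ comp₂-anti (≐-sym (fg≐id T PT))) ⟩
    g (comp₂ (f (g T)))       ≈⟨ Monotone-resp-≐ g-mono (≐-sym (f-comp (g T) PgT)) ⟩
    g (f (comp₁ (g T)))       ≈⟨ gf≐id _ (comp₁-closed _ PgT) ⟩
    comp₁ (g T)               ∎
    where PgT = g-into T PT

  f-Regular : ∀ S → Regular P₁ comp₁ S → Regular P₂ comp₂ (f S)
  f-Regular S (PS , ccS≐S) = f-into S PS , (begin-equality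
    comp₂ (comp₂ (f S))       ≈⟨ Antitone-resp-≐ comp₂-anti (≐-sym (f-comp S PS)) ⟩
    comp₂ (f (comp₁ S))       ≈⟨ ≐-sym (f-comp _ (comp₁-closed S PS)) ⟩
    f (comp₁ (comp₁ S))       ≈⟨ Monotone-resp-≐ f-mono ccS≐S ⟩
    f S                       ∎)

  g-Regular : ∀ T → Regular P₂ comp₂ T → Regular P₁ comp₁ (g T)
  g-Regular T (PT , ccT≐T) = g-into T PT , (begin-equality
    comp₁ (comp₁ (g T))       ≈⟨ Antitone-resp-≐ comp₁-anti (≐-sym (g-comp T PT)) ⟩
    comp₁ (g (comp₂ T))       ≈⟨ ≐-sym (g-comp _ (comp₂-closed T PT)) ⟩
    g (comp₂ (comp₂ T))       ≈⟨ Monotone-resp-≐ g-mono ccT≐T ⟩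
    g T                       ∎)

  isOLIso-Regular : IsOLIso (Regular P₁ comp₁) (Regular P₂ comp₂) comp₁ comp₂ f g
  isOLIso-Regular =
    OrderIsomorphism.isOLIso (Regular P₁ comp₁) (Regular P₂ comp₂) comp₁ comp₂ f g
      f-mono g-mono f-Regular g-Regular
      (λ S RS → gf≐id S (proj₁ RS)) (λ T RT → fg≐id T (proj₁ RT)) (λ S RS → f-comp S (proj₁ RS))

module WDLProperties (W : WDL) where
  open WDLNotions W
  open LS.IsLattice isLattice using (∧-comm)

  private
    lattice : Lattice _ _
    lattice = record { Carrier = Carrier ; _≈_ = _≡_ ; _∨_ = _∨_ ; _∧_ = _∧_ ; isLattice = isLattice }

    open LatticeProperties lattice using (∨-idem)
    -- The library orders a lattice by  x ≡ x ∧ y,  the WDL by  x ∧ y ≡ x.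
    module O = OrderTheoretic.Lattice (LatticeProperties.∨-∧-orderTheoreticLattice lattice)

  ≤-refl : ∀ {x} → x ≤ x
  ≤-refl = sym O.refl

  ≤-trans : ∀ {x y z} → x ≤ y → y ≤ z → x ≤ z
  ≤-trans x≤y y≤z = sym (O.trans (sym x≤y) (sym y≤z))

  ≤-antisym : ∀ {x y} → x ≤ y → y ≤ x → x ≡ y
  ≤-antisym x≤y y≤x = O.antisym (sym x≤y) (sym y≤x)

  x≤x∨y : ∀ x y → x ≤ x ∨ y
  x≤x∨y x y = sym (O.x≤x∨y x y)

  y≤x∨y : ∀ x y → y ≤ x ∨ y
  y≤x∨y x y = sym (O.y≤x∨y x y)

  ∨-least : ∀ {x y z} → x ≤ z → y ≤ z → x ∨ y ≤ z
  ∨-least x≤z y≤z = sym (O.∨-least (sym x≤z) (sym y≤z))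

  ∧-greatest : ∀ {x y z} → x ≤ y → x ≤ z → x ≤ y ∧ z
  ∧-greatest x≤y x≤z = sym (O.∧-greatest (sym x≤y) (sym x≤z))

  ∧-identityˡ : ∀ x → 𝟙 ∧ x ≡ x
  ∧-identityˡ x = trans (∧-comm 𝟙 x) (𝟙-greatest x)

  𝟙≤⇒≡𝟙 : ∀ {x} → 𝟙 ≤ x → x ≡ 𝟙
  𝟙≤⇒≡𝟙 {x} 𝟙≤x = ≤-antisym (𝟙-greatest x) 𝟙≤x

  ᐞᐞ-mono : ∀ {x y} → x ≤ y → x ᐞ ᐞ ≤ y ᐞ ᐞ
  ᐞᐞ-mono {x} {y} x≤y = ᐞ-anti _ _ (ᐞ-anti x y x≤y)

  ᐞ-swap : ∀ {x y} → x ᐞ ≤ y → y ᐞ ≤ x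
  ᐞ-swap {x} xᐞ≤y = ≤-trans (ᐞ-anti _ _ xᐞ≤y) (ᐞᐞ-≤ x)

  S̄-ᐞ : ∀ x → S̄ (x ᐞ)
  S̄-ᐞ x = ≤-antisym (ᐞᐞ-≤ (x ᐞ)) (ᐞ-anti _ _ (ᐞᐞ-≤ x))

  S̄-≤ᐞᐞ : ∀ {s x} → S̄ s → s ≤ x → s ≤ x ᐞ ᐞ
  S̄-≤ᐞᐞ {s} {x} s∈S̄ s≤x = subst (_≤ x ᐞ ᐞ) s∈S̄ (ᐞᐞ-mono s≤x)

  ∨-ᐞ≡𝟙 : ∀ x → x ∨ x ᐞ ≡ 𝟙
  ∨-ᐞ≡𝟙 x = begin
    x ∨ x ᐞ                ≡⟨ cong₂ _∨_ (sym (∧-identityˡ x)) (sym (∧-identityˡ (x ᐞ))) ⟩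
    (𝟙 ∧ x) ∨ (𝟙 ∧ x ᐞ)    ≡⟨ ᐞ-split 𝟙 x ⟩
    𝟙                      ∎
    where open ≡-Reasoning

  ᐞ≤⇒≡𝟙 : ∀ {x} → x ᐞ ≤ x → x ≡ 𝟙
  ᐞ≤⇒≡𝟙 {x} xᐞ≤x = 𝟙≤⇒≡𝟙 (subst (_≤ x) (∨-ᐞ≡𝟙 x) (∨-least ≤-refl xᐞ≤x))

  𝟘ᐞ≡𝟙 : 𝟘 ᐞ ≡ 𝟙
  𝟘ᐞ≡𝟙 = 𝟙≤⇒≡𝟙 (subst (_≤ 𝟘 ᐞ) (∨-ᐞ≡𝟙 𝟘) (∨-least (𝟘-least _) ≤-refl))

  𝟙ᐞ-least : ∀ x → 𝟙 ᐞ ≤ x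
  𝟙ᐞ-least x = ≤-trans (subst (λ z → z ᐞ ≤ 𝟘) 𝟘ᐞ≡𝟙 (ᐞᐞ-≤ 𝟘)) (𝟘-least x)

  S̄-𝟙 : S̄ 𝟙
  S̄-𝟙 = 𝟙≤⇒≡𝟙 (subst (_≤ 𝟙 ᐞ ᐞ) 𝟘ᐞ≡𝟙 (ᐞ-anti _ _ (𝟙ᐞ-least 𝟘)))

  ⊓̄≤ˡ : ∀ x y → x ⊓̄ y ≤ x
  ⊓̄≤ˡ x y = ≤-trans (ᐞ-anti _ _ (x≤x∨y (x ᐞ) (y ᐞ))) (ᐞᐞ-≤ x)

  ⊓̄≤ʳ : ∀ x y → x ⊓̄ y ≤ y
  ⊓̄≤ʳ x y = ≤-trans (ᐞ-anti _ _ (y≤x∨y (x ᐞ) (y ᐞ))) (ᐞᐞ-≤ y)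

  ⊓̄-greatest : ∀ {s x y} → S̄ s → s ≤ x → s ≤ y → s ≤ x ⊓̄ y
  ⊓̄-greatest {s} {x} {y} s∈S̄ s≤x s≤y =
    subst (_≤ x ⊓̄ y) s∈S̄ (ᐞ-anti _ _ (∨-least (ᐞ-anti _ _ s≤x) (ᐞ-anti _ _ s≤y)))

  ⊓̄≤ᐞᐞ∧ : ∀ x y → x ⊓̄ y ≤ (x ∧ y) ᐞ ᐞ
  ⊓̄≤ᐞᐞ∧ x y = S̄-≤ᐞᐞ (S̄-ᐞ _) (∧-greatest (⊓̄≤ˡ x y) (⊓̄≤ʳ x y))

  ⊓̄-idem : ∀ x → x ⊓̄ x ≡ x ᐞ ᐞ
  ⊓̄-idem x = cong _ᐞ (∨-idem (x ᐞ))

  ᐞᐞ-⊓̄-ᐞᐞ : ∀ x y → (x ᐞ ᐞ) ⊓̄ (y ᐞ ᐞ) ≡ x ⊓̄ y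
  ᐞᐞ-⊓̄-ᐞᐞ x y = cong₂ (λ a b → (a ∨ b) ᐞ) (S̄-ᐞ x) (S̄-ᐞ y)

  filterS̄-𝟙 : ∀ {G} → IsFilterS̄ G → G 𝟙
  filterS̄-𝟙 G-filter = let (x , Gx) = nonempty in up x 𝟙 Gx S̄-𝟙 (𝟙-greatest x)
    where open IsFilterS̄ G-filter

  filter-𝟙 : ∀ {F} → IsFilter F → F 𝟙
  filter-𝟙 F-filter = let (x , Fx) = nonempty in up x 𝟙 Fx (𝟙-greatest x)
    where open IsFilter F-filter

  sfilter-ᐞᐞ : ∀ {F x} → IsSFilter F → F x → F (x ᐞ ᐞ)
  sfilter-ᐞᐞ {F} {x} F-sfilter Fx = subst F (⊓̄-idem x) (IsSFilter.⊓̄-closed F-sfilter x x Fx Fx)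

  S̄-filterS̄ : IsFilterS̄ S̄
  S̄-filterS̄ = record
    { inside   = λ _ x∈S̄ → x∈S̄
    ; nonempty = 𝟙 , S̄-𝟙
    ; up       = λ _ _ _ y∈S̄ _ → y∈S̄
    ; meet     = λ x y _ _ → S̄-ᐞ _
    }

  Full-sfilter : IsSFilter Full
  Full-sfilter = record
    { isFilter = record { nonempty = 𝟙 , tt ; up = λ _ _ _ _ → tt ; meet = λ _ _ _ _ → tt }
    ; ⊓̄-closed = λ _ _ _ _ → tt
    }

  ∩-filterS̄ : ∀ G H → IsFilterS̄ G → IsFilterS̄ H → IsFilterS̄ (G ∩ H)
  ∩-filterS̄ G H G-filter H-filter = record
    { inside   = λ x (Gx , _) → G.inside x Gx
    ; nonempty = 𝟙 , filterS̄-𝟙 G-filter , filterS̄-𝟙 H-filter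
    ; up       = λ x y (Gx , Hx) y∈S̄ x≤y → G.up x y Gx y∈S̄ x≤y , H.up x y Hx y∈S̄ x≤y
    ; meet     = λ x y (Gx , Hx) (Gy , Hy) → G.meet x y Gx Gy , H.meet x y Hx Hy
    }
    where
      module G = IsFilterS̄ G-filter
      module H = IsFilterS̄ H-filter

  ∩-filter : ∀ F E → IsFilter F → IsFilter E → IsFilter (F ∩ E)
  ∩-filter F E F-filter E-filter = record
    { nonempty = 𝟙 , filter-𝟙 F-filter , filter-𝟙 E-filter
    ; up       = λ x y (Fx , Ex) x≤y → F.up x y Fx x≤y , E.up x y Ex x≤y
    ; meet     = λ x y (Fx , Ex) (Fy , Ey) → F.meet x y Fx Fy , E.meet x y Ex Ey
    }
    where
      module F = IsFilter F-filter
      module E = IsFilter E-filter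

  ∩-sfilter : ∀ F E → IsSFilter F → IsSFilter E → IsSFilter (F ∩ E)
  ∩-sfilter F E F-sfilter E-sfilter = record
    { isFilter = ∩-filter F E F.isFilter E.isFilter
    ; ⊓̄-closed = λ x y (Fx , Ex) (Fy , Ey) → F.⊓̄-closed x y Fx Fy , E.⊓̄-closed x y Ex Ey
    }
    where
      module F = IsSFilter F-sfilter
      module E = IsSFilter E-sfilter

  F[]-sfilter : ∀ {G} → IsFilterS̄ G → IsSFilter F[ G ]
  F[]-sfilter {G} G-filter = record
    { isFilter = record
      { nonempty = 𝟙 , subst G (sym S̄-𝟙) (filterS̄-𝟙 G-filter)
      ; up       = λ x y Gxᐞᐞ x≤y → up _ _ Gxᐞᐞ (S̄-ᐞ _) (ᐞᐞ-mono x≤y)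
      ; meet     = λ x y Gxᐞᐞ Gyᐞᐞ → up _ _ (G-⊓̄ Gxᐞᐞ Gyᐞᐞ) (S̄-ᐞ _) (⊓̄≤ᐞᐞ∧ x y)
      }
    ; ⊓̄-closed = λ x y Gxᐞᐞ Gyᐞᐞ → subst G (sym (S̄-ᐞ _)) (G-⊓̄ Gxᐞᐞ Gyᐞᐞ)
    }
    where
      open IsFilterS̄ G-filter
      G-⊓̄ : ∀ {x y} → G (x ᐞ ᐞ) → G (y ᐞ ᐞ) → G (x ⊓̄ y)
      G-⊓̄ {x} {y} Gxᐞᐞ Gyᐞᐞ = subst G (ᐞᐞ-⊓̄-ᐞᐞ x y) (meet _ _ Gxᐞᐞ Gyᐞᐞ)

  S̄∩-filterS̄ : ∀ {F} → IsSFilter F → IsFilterS̄ (S̄ ∩ F)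
  S̄∩-filterS̄ F-sfilter = record
    { inside   = λ _ → proj₁
    ; nonempty = 𝟙 , S̄-𝟙 , filter-𝟙 isFilter
    ; up       = λ x y (_ , Fx) y∈S̄ x≤y → y∈S̄ , IsFilter.up isFilter x y Fx x≤y
    ; meet     = λ x y (_ , Fx) (_ , Fy) → S̄-ᐞ _ , ⊓̄-closed x y Fx Fy
    }
    where open IsSFilter F-sfilter

  ⋆-sfilter : ∀ X → IsSFilter (X ⋆)
  ⋆-sfilter X = record
    { isFilter = record
      { nonempty = 𝟙 , (λ x _ → 𝟙-greatest _)
      ; up       = λ x y X⋆x x≤y a Xa → ≤-trans (X⋆x a Xa) x≤y
      ; meet     = λ x y X⋆x X⋆y a Xa → ∧-greatest (X⋆x a Xa) (X⋆y a Xa)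
      }
    ; ⊓̄-closed = λ x y X⋆x X⋆y a Xa → ⊓̄-greatest (S̄-ᐞ a) (X⋆x a Xa) (X⋆y a Xa)
    }

  -- X ⋆̄ and S̄ ∩ (X ⋆) are the same predicate by definition.
  ⋆̄-filterS̄ : ∀ X → IsFilterS̄ (X ⋆̄)
  ⋆̄-filterS̄ X = S̄∩-filterS̄ (⋆-sfilter X)

  ⋆-anti : Antitone _⋆
  ⋆-anti X Y X⊆Y x Y⋆x a Xa = Y⋆x a (X⊆Y a Xa)

  ⋆̄-anti : Antitone _⋆̄
  ⋆̄-anti X Y X⊆Y x (x∈S̄ , Y⋆x) = x∈S̄ , ⋆-anti X Y X⊆Y x Y⋆x

  ⋆-extensive : ∀ X → X ⊆ X ⋆ ⋆
  ⋆-extensive X x Xx a X⋆a = ᐞ-swap (X⋆a x Xx)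

  ⋆̄-extensive : ∀ X → X ⊆ S̄ → X ⊆ X ⋆̄ ⋆̄
  ⋆̄-extensive X X⊆S̄ x Xx = X⊆S̄ x Xx , λ a (_ , X⋆a) → ⋆-extensive X x Xx a X⋆a

  ⋆-disjoint : ∀ X → X ∩ (X ⋆) ⊆ ｛𝟙｝
  ⋆-disjoint X x (Xx , X⋆x) = ᐞ≤⇒≡𝟙 (X⋆x x Xx)

  ⋆-of-⊆｛𝟙｝ : ∀ X → X ⊆ ｛𝟙｝ → Full ⊆ X ⋆
  ⋆-of-⊆｛𝟙｝ X X⊆｛𝟙｝ x _ a Xa = subst (λ b → b ᐞ ≤ x) (sym (X⊆｛𝟙｝ a Xa)) (𝟙ᐞ-least x)

  ⋆̄-disjoint : ∀ X → X ∩ (X ⋆̄) ⊆ ｛𝟙｝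
  ⋆̄-disjoint X x (Xx , _ , X⋆x) = ⋆-disjoint X x (Xx , X⋆x)

  ⋆̄-of-⊆｛𝟙｝ : ∀ X → X ⊆ ｛𝟙｝ → S̄ ⊆ X ⋆̄
  ⋆̄-of-⊆｛𝟙｝ X X⊆｛𝟙｝ x x∈S̄ = x∈S̄ , ⋆-of-⊆｛𝟙｝ X X⊆｛𝟙｝ x tt

  F[]-mono : Monotone F[_]
  F[]-mono G H G⊆H x = G⊆H (x ᐞ ᐞ)

  S̄∩-mono : Monotone (S̄ ∩_)
  S̄∩-mono F E F⊆E x (x∈S̄ , Fx) = x∈S̄ , F⊆E x Fx

  S̄∩F[]≐ : ∀ G → G ⊆ S̄ → S̄ ∩ F[ G ] ≐ G
  S̄∩F[]≐ G G⊆S̄ =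
    (λ x (x∈S̄ , Gxᐞᐞ) → subst G x∈S̄ Gxᐞᐞ) ,
    (λ x Gx → G⊆S̄ x Gx , subst G (sym (G⊆S̄ x Gx)) Gx)

  F[S̄∩]≐ : ∀ F → IsSFilter F → F[ S̄ ∩ F ] ≐ F
  F[S̄∩]≐ F F-sfilter =
    (λ x (_ , Fxᐞᐞ) → IsFilter.up (IsSFilter.isFilter F-sfilter) _ x Fxᐞᐞ (ᐞᐞ-≤ x)) ,
    (λ x Fx → S̄-ᐞ (x ᐞ) , sfilter-ᐞᐞ F-sfilter Fx)

  F[⋆̄]≐F[]⋆ : ∀ G → G ⊆ S̄ → F[ G ⋆̄ ] ≐ F[ G ] ⋆
  F[⋆̄]≐F[]⋆ G G⊆S̄ =
    (λ x (_ , G⋆xᐞᐞ) y Gyᐞᐞ → ≤-trans (subst (_≤ x ᐞ ᐞ) (S̄-ᐞ y) (G⋆xᐞᐞ _ Gyᐞᐞ)) (ᐞᐞ-≤ x)) ,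
    (λ x F[G]⋆x → S̄-ᐞ _ , λ a Ga → S̄-≤ᐞᐞ (S̄-ᐞ a) (F[G]⋆x a (subst G (sym (G⊆S̄ a Ga)) Ga)))

  F[｛𝟙｝]≐｛𝟙｝ : F[ ｛𝟙｝ ] ≐ ｛𝟙｝
  F[｛𝟙｝]≐｛𝟙｝ =
    (λ x xᐞᐞ≡𝟙 → 𝟙≤⇒≡𝟙 (subst (_≤ x) xᐞᐞ≡𝟙 (ᐞᐞ-≤ x))) ,
    (λ x x≡𝟙 → subst (λ z → z ᐞ ᐞ ≡ 𝟙) (sym x≡𝟙) S̄-𝟙)

  F[S̄]≐Full : F[ S̄ ] ≐ Full
  F[S̄]≐Full = (λ _ _ → tt) , (λ x _ → S̄-ᐞ (x ᐞ))

  module FilterIso = OrderIsomorphism IsFilterS̄ IsSFilter _⋆̄ _⋆ F[_] (S̄ ∩_)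
    F[]-mono S̄∩-mono (λ _ → F[]-sfilter) (λ _ → S̄∩-filterS̄)
    (λ G G-filter → S̄∩F[]≐ G (IsFilterS̄.inside G-filter)) F[S̄∩]≐
    (λ G G-filter → F[⋆̄]≐F[]⋆ G (IsFilterS̄.inside G-filter))

  module RegularFilterIso = RegularOrderIsomorphism F[]-mono S̄∩-mono FilterIso.isOLIso
    ⋆̄-anti ⋆-anti (λ G _ → ⋆̄-filterS̄ G) (λ F _ → ⋆-sfilter F)

  module RegularFiltersS̄ = RegularOrthoLattice IsFilterS̄ _⋆̄ S̄ ｛𝟙｝
    ∩-filterS̄ S̄-filterS̄ (λ _ → IsFilterS̄.inside)
    (λ G G-filter x x≡𝟙 → subst G (sym x≡𝟙) (filterS̄-𝟙 G-filter))
    ⋆̄-filterS̄ ⋆̄-anti (λ G G-filter → ⋆̄-extensive G (IsFilterS̄.inside G-filter))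
    ⋆̄-disjoint ⋆̄-of-⊆｛𝟙｝

  module RegularSFilters = RegularOrthoLattice IsSFilter _⋆ Full ｛𝟙｝
    ∩-sfilter Full-sfilter (λ _ _ _ _ → tt)
    (λ F F-sfilter x x≡𝟙 → subst F (sym x≡𝟙) (filter-𝟙 (IsSFilter.isFilter F-sfilter)))
    ⋆-sfilter ⋆-anti (λ F _ → ⋆-extensive F)
    ⋆-disjoint ⋆-of-⊆｛𝟙｝

theorem4p11 : (W : WDL) → let open WDLNotions W in
    -- (1) G ↦ F_G maps F(S̄(L)) into F(L), injectively and order-preservingly
    ( (∀ G → IsFilterS̄ G → IsFilter F[ G ])
      × (∀ G H → IsFilterS̄ G → IsFilterS̄ H → F[ G ] ≐ F[ H ] → G ≐ H)
      × (∀ G H → IsFilterS̄ G → IsFilterS̄ H → G ⊆ H → F[ G ] ⊆ F[ H ]) )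
    -- (2) (F(S̄(L)); ∩, ∨, ⋆̄, {1}, S̄(L)) ≅ (SF(L); ∩, ∨, ⋆, {1}, L)
    × Σ (Subset {Carrier} → Subset {Carrier}) (λ f → Σ (Subset {Carrier} → Subset {Carrier}) (λ g →
        IsOLIso IsFilterS̄ IsSFilter _⋆̄ _⋆ f g
        × (∀ G H → IsFilterS̄ G → IsFilterS̄ H → f (G ∩ H) ≐ (f G ∩ f H))
        × (f ｛𝟙｝ ≐ ｛𝟙｝)
        × (f S̄ ≐ Full)))
    -- (3) S(F(S̄(L))) and S(SF(L)) are ortholattices, and isomorphic ones
    × ( IsOrthoLattice IsRegFilterS̄ _⋆̄
        × IsOrthoLattice IsRegSFilter _⋆
        × Σ (Subset {Carrier} → Subset {Carrier}) (λ f → Σ (Subset {Carrier} → Subset {Carrier}) (λ g →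
            IsOLIso IsRegFilterS̄ IsRegSFilter _⋆̄ _⋆ f g)) )
theorem4p11 W =
  ( (λ _ G-filter → IsSFilter.isFilter (F[]-sfilter G-filter))
  , (λ _ _ → FilterIso.f-injective)
  , (λ G H _ _ → F[]-mono G H) )
  , ( F[_] , (S̄ ∩_) , FilterIso.isOLIso
    , (λ _ _ _ _ → ≐-refl) , F[｛𝟙｝]≐｛𝟙｝ , F[S̄]≐Full )
  , ( RegularFiltersS̄.isOrthoLattice , RegularSFilters.isOrthoLattice
    , F[_] , (S̄ ∩_) , RegularFilterIso.isOLIso-Regular )
  where
    open WDLNotions W
    open WDLProperties W
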